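{- Let $\Gamma$ be a finitely generated abelian group and $\mathcal{A}$ a finite list of elements of $\Gamma$ with $\mathcal{A}^{\mathrm{tor}}\neq\emptyset$. Then $f^1_{\mathcal{A}}(t)=0$.
   Context: $\Gamma_{\mathrm{tor}}$ is the torsion subgroup of $\Gamma$ and $\mathcal{A}^{\mathrm{tor}}:=\mathcal{A}\cap\Gamma_{\mathrm{tor}}$. For each sublist $\mathcal{S}\subseteq\mathcal{A}$ write $\Gamma/\langle\mathcal{S}\rangle\simeq\bigoplus_{i=1}^{n_{\mathcal{S}}}\mathbb{Z}/d_{\mathcal{S},i}\mathbb{Z}\oplus\mathbb{Z}^{m}$ with $1<d_{\mathcal{S},i}\mid d_{\mathcal{S},i+1}$ (and $d_{\mathcal{S},n_{\mathcal{S}}}:=1$ if $n_{\mathcal{S}}=0$), where $\langle\mathcal{S}\rangle$ is the subgroup generated by $\mathcal{S}$; the LCM-period is $\rho_{\mathcal{A}}:=\operatorname{lcm}(d_{\mathcal{S},n_{\mathcal{S}}}\mid\mathcal{S}\subseteq\mathcal{A})$. The chromatic quasi-polynomial $\chi^{\mathrm{quasi}}_{\mathcal{A}}(q):=\#\{\varphi\in\operatorname{Hom}(\Gamma,\mathbb{Z}/q\mathbb{Z})\mid\varphi(\alpha)\ne\overline0\ \forall\alpha\in\mathcal{A}\}$ is known to be a quasi-polynomial with period $\rho_{\mathcal{A}}$; $f^1_{\mathcal{A}}(t)\in\mathbb{Z}[t]$ denotes its $1$-constituent, the polynomial with $\chi^{\mathrm{quasi}}_{\mathcal{A}}(q)=f^1_{\mathcal{A}}(q)$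 for all $q\in\mathbb{Z}_{>0}$ with $q\equiv1\bmod\rho_{\mathcal{A}}$. -}

module Defs where

open import Data.Nat as ℕ using (ℕ; zero; suc; _≤_; _<_)
open import Data.Nat.Divisibility using (_∣_; _∣?_)
open import Data.Integer as ℤ using (ℤ; +_; ∣_∣)
open import Data.Fin using (Fin; zero; suc; toℕ; fromℕ; _↑ˡ_; _↑ʳ_)
open import Data.Fin.Subset using (Subset)
open import Data.Bool using (true; false)
open import Data.Vec using (Vec; []; _∷_)
open import Data.List using (List; []; _∷_; length; map; concatMap; filter)
open import Data.List.Relation.Unary.All using (All; all?)
open import Data.Product using (Σ; _×_; ∃; _,_)
open import Relation.Nullary using (¬_; Dec)
open import Relation.Nullary.Decidable using (_×-dec_; ¬?)
open import Relation.Binary.PropositionalEquality using (_≡_)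
open import Function using (_∘_; _⇔_)

Vecℤ : ℕ → Set
Vecℤ n = Fin n → ℤ

comb : ∀ {n} (rs : List (Vecℤ n)) → Vec ℤ (length rs) → Vecℤ n
comb []       []       = λ _ → + 0
comb (r ∷ rs) (c ∷ cs) = λ i → c ℤ.* r i ℤ.+ comb rs cs i

InSpan : ∀ {n} → List (Vecℤ n) → Vecℤ n → Set
InSpan rs x = Σ (Vec ℤ (length rs)) λ cs → ∀ i → comb rs cs i ≡ x i

-- A finitely generated abelian group is presented as  ℤ^n / ⟨R⟩  for a
-- finite list R of relation vectors; an element is represented by a
-- vector of ℤ^n.

IsTorsion : ∀ {n} → List (Vecℤ n) → Vecℤ n → Set
IsTorsion R x = ∃ λ (k : ℕ) → (1 ≤ k) × InSpan R (λ i → + k ℤ.* x i)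

-- Invariant factor decomposition of  ℤ^n / ⟨R⟩ :
--   ℤ^n / ⟨R⟩ ≅ ⊕_{i<k} ℤ/d_i ⊕ ℤ^m ,  1 < d_i ∣ d_j for i ≤ j,
-- the isomorphism being induced by an integer matrix M : ℤ^n → ℤ^(k+m).
sumFin : ∀ {l} → (Fin l → ℤ) → ℤ
sumFin {zero}  f = + 0
sumFin {suc l} f = f zero ℤ.+ sumFin (f ∘ suc)

applyMat : ∀ {r n} → (Fin r → Fin n → ℤ) → Vecℤ n → Vecℤ r
applyMat M x j = sumFin (λ i → M j i ℤ.* x i)

TargetZero : (k : ℕ) → (Fin k → ℕ) → (m : ℕ) → Vecℤ (k ℕ.+ m) → Set
TargetZero k d m y = (∀ i → d i ∣ ∣ y (i ↑ˡ m) ∣) × (∀ j → y (k ↑ʳ j) ≡ + 0)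

record InvFactorDecomp {n : ℕ} (R : List (Vecℤ n)) : Set where
  field
    k   : ℕ
    d   : Fin k → ℕ
    m   : ℕ
    M   : Fin (k ℕ.+ m) → Fin n → ℤ
    d>1 : ∀ i → 1 < d i
    d∣d : ∀ i j → toℕ i ≤ toℕ j → d i ∣ d j
    -- kernel of the induced map is exactly ⟨R⟩ (well defined and injective)
    kernel : ∀ x → InSpan R x ⇔ TargetZero k d m (applyMat M x)
    surj   : ∀ (y : Vecℤ (k ℕ.+ m)) → ∃ λ (x : Vecℤ n) → TargetZero k d m (λ j → applyMat M x j ℤ.- y j)

-- largest invariant factor d_{n_S}, with the convention 1 if there is none
lastFactor : (k : ℕ) → (Fin k → ℕ) → ℕ
lastFactor zero    d = 1
lastFactor (suc k) d = d (fromℕ k)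

IsLastInvFactor : ∀ {n} → List (Vecℤ n) → ℕ → Set
IsLastInvFactor R D =
  Σ (InvFactorDecomp R) λ dec →
    D ≡ lastFactor (InvFactorDecomp.k dec) (InvFactorDecomp.d dec)

select : ∀ {a} {X : Set a} (A : List X) → Subset (length A) → List X
select []      []           = []
select (a ∷ A) (true  ∷ s)  = a ∷ select A s
select (a ∷ A) (false ∷ s)  = select A s

IsLCM : ∀ {I : Set} → (I → ℕ) → ℕ → Set
IsLCM {I} D ρ = (∀ s → D s ∣ ρ) × (∀ m → (∀ s → D s ∣ m) → ρ ∣ m)

-- Chromatic quasi-polynomial.  A homomorphism ℤ^n/⟨R⟩ → ℤ/qℤ is the same
-- as an assignment g of the generators to ℤ/qℤ = Fin q killing every
-- relation.

allVecs : (q n : ℕ) → List (Vec (Fin q) n)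
allVecs q zero    = [] ∷ []
allVecs q (suc n) = concatMap (λ a → map (a ∷_) (allVecs q n)) (allFinList q)
  where
  allFinList : (q : ℕ) → List (Fin q)
  allFinList zero    = []
  allFinList (suc q) = zero ∷ map suc (allFinList q)

-- value φ_g(x) ∈ ℤ (to be read mod q)
ev : ∀ {q n} → Vecℤ n → Vec (Fin q) n → ℤ
ev {n = zero}  x []       = + 0
ev {n = suc n} x (g ∷ gs) = x zero ℤ.* + toℕ g ℤ.+ ev (x ∘ suc) gs

ZeroMod : ℕ → ℤ → Set
ZeroMod q z = q ∣ ∣ z ∣

IsHom : ∀ {q n} → List (Vecℤ n) → Vec (Fin q) n → Set
IsHom {q} R g = All (λ r → ZeroMod q (ev r g)) R

NowhereZero : ∀ {q n} → List (Vecℤ n) → Vec (Fin q) n → Set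
NowhereZero {q} A g = All (λ a → ¬ ZeroMod q (ev a g)) A

good? : ∀ {q n} (R A : List (Vecℤ n)) (g : Vec (Fin q) n) →
        Dec (IsHom R g × NowhereZero A g)
good? {q} R A g =
  all? (λ r → q ∣? ∣ ev r g ∣) R ×-dec all? (λ a → ¬? (q ∣? ∣ ev a g ∣)) A

chi : ∀ {n} → ℕ → List (Vecℤ n) → List (Vecℤ n) → ℕ
chi {n} q R A = length (filter (good? R A) (allVecs q n))

{-# OPTIONS --safe #-}
module Submission where

-- For the empty sublist ⊥, D ⊥ is the largest invariant factor of
-- Γ = ℤⁿ/⟨R⟩; every invariant factor divides it, so it annihilates the
-- torsion part: D ⊥ · α ∈ ⟨R⟩.  Every homomorphism φ : Γ → ℤ/q thus has
-- q ∣ D ⊥ · φ(α).  As D ⊥ ∣ ρ ∣ q − 1, q is coprime to D ⊥, so q ∣ φ(α)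
-- and no homomorphism is nowhere zero on A.

open import Defs
open import Data.Nat using (ℕ; _≤_; _∸_)
open import Data.Nat.Divisibility using (_∣_)
open import Data.List using (List; length; _++_)
open import Data.List.Membership.Propositional using (_∈_)
open import Data.Fin.Subset using (Subset)
open import Data.Product using (∃; _×_)
open import Relation.Binary.PropositionalEquality using (_≡_)

import Data.Nat as ℕ
import Data.Nat.Properties as ℕ
import Data.Nat.Divisibility as ℕ
open import Data.Nat.Coprimality using (Coprime; coprime-divisor)
open import Data.Integer as ℤ using (ℤ; +_; ∣_∣)
import Data.Integer.Properties as ℤ
import Data.Integer.Divisibility.Signed as ℤ
open import Data.Integer.Tactic.RingSolver using (solve-∀)
open import Data.Fin using (Fin; zero; suc; toℕ; fromℕ; _↑ˡ_; _↑ʳ_)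
import Data.Fin.Properties as Fin
open import Data.Fin.Subset using (⊥)
open import Data.Vec using (Vec; []; _∷_)
open import Data.List using ([]; _∷_)
open import Data.List.Properties using (++-identityʳ; filter-none)
open import Data.List.Relation.Unary.All as All using ([]; _∷_)
open import Data.Product using (_,_)
open import Data.Sum using (inj₁; inj₂)
open import Data.Empty using (⊥-elim)
open import Relation.Nullary using (¬_)
open import Relation.Binary.PropositionalEquality
  using (refl; sym; trans; cong; cong₂; subst; module ≡-Reasoning)
open import Function using (_∘_; Equivalence)

sumFin-cong : ∀ {l} {f g : Fin l → ℤ} → (∀ i → f i ≡ g i) → sumFin f ≡ sumFin g
sumFin-cong {ℕ.zero}  f≗g = refl
sumFin-cong {ℕ.suc l} f≗g = cong₂ ℤ._+_ (f≗g zero) (sumFin-cong (f≗g ∘ suc))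

sumFin-*ˡ : ∀ {l} (c : ℤ) (f : Fin l → ℤ) → sumFin (λ i → c ℤ.* f i) ≡ c ℤ.* sumFin f
sumFin-*ˡ {ℕ.zero}  c f = sym (ℤ.*-zeroʳ c)
sumFin-*ˡ {ℕ.suc l} c f =
  trans (cong (ℤ._+_ (c ℤ.* f zero)) (sumFin-*ˡ c (f ∘ suc)))
        (sym (ℤ.*-distribˡ-+ c (f zero) (sumFin (f ∘ suc))))

applyMat-*ˡ : ∀ {r n} (M : Fin r → Fin n → ℤ) (c : ℤ) (x : Vecℤ n) j →
              applyMat M (λ i → c ℤ.* x i) j ≡ c ℤ.* applyMat M x j
applyMat-*ˡ M c x j = trans (sumFin-cong (λ i → swap-* (M j i) c (x i))) (sumFin-*ˡ c (λ i → M j i ℤ.* x i))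
  where
  swap-* : ∀ a c b → a ℤ.* (c ℤ.* b) ≡ c ℤ.* (a ℤ.* b)
  swap-* = solve-∀

ev-cong : ∀ {q n} {x y : Vecℤ n} (g : Vec (Fin q) n) → (∀ i → x i ≡ y i) → ev x g ≡ ev y g
ev-cong []       x≗y = refl
ev-cong (g ∷ gs) x≗y = cong₂ ℤ._+_ (cong (ℤ._* + toℕ g) (x≗y zero)) (ev-cong gs (x≗y ∘ suc))

ev-zero : ∀ {q n} (g : Vec (Fin q) n) → ev (λ _ → + 0) g ≡ + 0
ev-zero []       = refl
ev-zero (g ∷ gs) = trans (ℤ.+-identityˡ _) (ev-zero gs)

ev-*-+ : ∀ {q n} (c : ℤ) (x y : Vecℤ n) (g : Vec (Fin q) n) →
         ev (λ i → c ℤ.* x i ℤ.+ y i) g ≡ c ℤ.* ev x g ℤ.+ ev y g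
ev-*-+ c x y []       = sym (trans (ℤ.+-identityʳ _) (ℤ.*-zeroʳ c))
ev-*-+ c x y (g ∷ gs) =
  trans (cong (ℤ._+_ ((c ℤ.* x zero ℤ.+ y zero) ℤ.* + toℕ g)) (ev-*-+ c (x ∘ suc) (y ∘ suc) gs))
        (regroup c (x zero) (y zero) (+ toℕ g) (ev (x ∘ suc) gs) (ev (y ∘ suc) gs))
  where
  regroup : ∀ c a b t u v →
            (c ℤ.* a ℤ.+ b) ℤ.* t ℤ.+ (c ℤ.* u ℤ.+ v) ≡ c ℤ.* (a ℤ.* t ℤ.+ u) ℤ.+ (b ℤ.* t ℤ.+ v)
  regroup = solve-∀

ev-*ˡ : ∀ {q n} (c : ℤ) (x : Vecℤ n) (g : Vec (Fin q) n) →
        ev (λ i → c ℤ.* x i) g ≡ c ℤ.* ev x g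
ev-*ˡ c x g = begin
  ev (λ i → c ℤ.* x i) g               ≡⟨ ev-cong g (λ i → sym (ℤ.+-identityʳ (c ℤ.* x i))) ⟩
  ev (λ i → c ℤ.* x i ℤ.+ + 0) g       ≡⟨ ev-*-+ c x (λ _ → + 0) g ⟩
  c ℤ.* ev x g ℤ.+ ev (λ _ → + 0) g    ≡⟨ cong (ℤ._+_ (c ℤ.* ev x g)) (ev-zero g) ⟩
  c ℤ.* ev x g ℤ.+ + 0                 ≡⟨ ℤ.+-identityʳ _ ⟩
  c ℤ.* ev x g                         ∎
  where open ≡-Reasoning

d∣lastFactor : ∀ k (d : Fin k → ℕ) → (∀ i j → toℕ i ≤ toℕ j → d i ∣ d j) →
               ∀ i → d i ∣ lastFactor k d
d∣lastFactor (ℕ.suc k) d d∣d i =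
  d∣d i (fromℕ k) (subst (toℕ i ≤_) (sym (Fin.toℕ-fromℕ k)) (Fin.toℕ≤pred[n] i))

TargetZero-cong : ∀ {k d m} {y y′ : Vecℤ (k ℕ.+ m)} → (∀ j → y j ≡ y′ j) →
                  TargetZero k d m y → TargetZero k d m y′
TargetZero-cong {d = d} y≗y′ (tors , free) =
  (λ i → subst (λ z → d i ∣ ∣ z ∣) (y≗y′ _) (tors i)) ,
  (λ j → trans (sym (y≗y′ _)) (free j))

TargetZero-free : ∀ {k d m K} {y : Vecℤ (k ℕ.+ m)} → 1 ≤ K →
                  TargetZero k d m (λ j → + K ℤ.* y j) → ∀ j → y (k ↑ʳ j) ≡ + 0
TargetZero-free {K = K} 1≤K (_ , free) j with ℤ.i*j≡0⇒i≡0∨j≡0 (+ K) (free j)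
... | inj₁ K≡0  = ⊥-elim (ℕ.<⇒≢ 1≤K (sym (cong ∣_∣ K≡0)))
... | inj₂ y≡0 = y≡0

lastFactor-*-TargetZero : ∀ {k d m} {y : Vecℤ (k ℕ.+ m)} →
                          (∀ i j → toℕ i ≤ toℕ j → d i ∣ d j) → (∀ j → y (k ↑ʳ j) ≡ + 0) →
                          TargetZero k d m (λ j → + lastFactor k d ℤ.* y j)
lastFactor-*-TargetZero {k} {d} {m} {y} d∣d free =
  (λ i → subst (d i ∣_) (sym (ℤ.abs-* (+ lastFactor k d) (y (i ↑ˡ m))))
                 (ℕ.∣m⇒∣m*n ∣ y (i ↑ˡ m) ∣ (d∣lastFactor k d d∣d i))) ,
  (λ j → trans (cong (+ lastFactor k d ℤ.*_) (free j)) (ℤ.*-zeroʳ (+ lastFactor k d)))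

lastInvFactor-*-torsion∈span : ∀ {n} {R : List (Vecℤ n)} {D α} →
                               IsLastInvFactor R D → IsTorsion R α → InSpan R (λ i → + D ℤ.* α i)
lastInvFactor-*-torsion∈span {α = α} (dec , refl) (K , 1≤K , Kα∈R) =
  Equivalence.from (kernel _)
    (TargetZero-cong (λ j → sym (applyMat-*ˡ M (+ lastFactor k d) α j))
      (lastFactor-*-TargetZero {y = applyMat M α} d∣d
        (TargetZero-free {d = d} {y = applyMat M α} 1≤K
          (TargetZero-cong (applyMat-*ˡ M (+ K) α) (Equivalence.to (kernel _) Kα∈R)))))
  where open InvFactorDecomp dec

hom-kills-comb : ∀ {q n} (rs : List (Vecℤ n)) (cs : Vec ℤ (length rs)) (g : Vec (Fin q) n) →
                 IsHom rs g → + q ℤ.∣ ev (comb rs cs) g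
hom-kills-comb []       []       g []       =
  subst (_ ℤ.∣_) (sym (ev-zero g)) (ℤ.∣ᵤ⇒∣ (_ ℕ.∣0))
hom-kills-comb (r ∷ rs) (c ∷ cs) g (q∣r ∷ hom) =
  subst (_ ℤ.∣_) (sym (ev-*-+ c r (comb rs cs) g))
    (ℤ.∣m∣n⇒∣m+n (ℤ.∣n⇒∣m*n c (ℤ.∣ᵤ⇒∣ q∣r)) (hom-kills-comb rs cs g hom))

hom-kills-span : ∀ {q n} {R : List (Vecℤ n)} {x} (g : Vec (Fin q) n) →
                 IsHom R g → InSpan R x → + q ℤ.∣ ev x g
hom-kills-span {R = R} g hom (cs , comb≗x) =
  subst (_ ℤ.∣_) (ev-cong g comb≗x) (hom-kills-comb R cs g hom)

hom-kills-coprime-torsion : ∀ {q n D} {R : List (Vecℤ n)} {α} (g : Vec (Fin q) n) →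
                            Coprime q D → InSpan R (λ i → + D ℤ.* α i) → IsHom R g →
                            ZeroMod q (ev α g)
hom-kills-coprime-torsion {q} {D = D} {α = α} g q⊥D Dα∈R hom =
  coprime-divisor q⊥D
    (subst (q ∣_) (ℤ.abs-* (+ D) (ev α g))
      (ℤ.∣⇒∣ᵤ (subst (_ ℤ.∣_) (ev-*ˡ (+ D) α g) (hom-kills-span g hom Dα∈R))))

coprime-∣pred : ∀ {q D} → 1 ≤ q → D ∣ q ∸ 1 → Coprime q D
coprime-∣pred {q} 1≤q D∣q∸1 (e∣q , e∣D) =
  ℕ.∣1⇒≡1 (ℕ.∣m+n∣m⇒∣n (subst (_ ∣_) (sym (ℕ.m∸n+n≡m 1≤q)) e∣q) (ℕ.∣-trans e∣D D∣q∸1))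

select-⊥ : ∀ {X : Set} (A : List X) → select A ⊥ ≡ []
select-⊥ []      = refl
select-⊥ (a ∷ A) = select-⊥ A

proposition4p5 : ∀ {n : ℕ} (R A : List (Vecℤ n)) →
    (∃ λ α → α ∈ A × IsTorsion R α) →
    (D : Subset (length A) → ℕ) →
    (∀ s → IsLastInvFactor (R ++ select A s) (D s)) →
    (ρ : ℕ) → IsLCM D ρ →
    ∀ (q : ℕ) → 1 ≤ q → ρ ∣ q ∸ 1 → chi q R A ≡ 0
proposition4p5 {n} R A (α , α∈A , α-torsion) D D-last ρ (D∣ρ , _) q 1≤q ρ∣q∸1 =
  cong length (filter-none (good? R A) {allVecs q n} (All.tabulate λ {g} _ → not-good g))
  where
  R++∅≡R : R ++ select A ⊥ ≡ R
  R++∅≡R = trans (cong (R ++_) (select-⊥ A)) (++-identityʳ R)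

  D∅α∈R : InSpan R (λ i → + D ⊥ ℤ.* α i)
  D∅α∈R = lastInvFactor-*-torsion∈span
            (subst (λ L → IsLastInvFactor L (D ⊥)) R++∅≡R (D-last ⊥)) α-torsion

  q⊥D∅ : Coprime q (D ⊥)
  q⊥D∅ = coprime-∣pred 1≤q (ℕ.∣-trans (D∣ρ ⊥) ρ∣q∸1)

  not-good : (g : Vec (Fin q) n) → ¬ (IsHom R g × NowhereZero A g)
  not-good g (hom , nowhere-zero) =
    All.lookup nowhere-zero α∈A (hom-kills-coprime-torsion g q⊥D∅ D∅α∈R hom)
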